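{- Let $n\ge 1$ and let $\pi_n\in\mathcal{S}_n$ be any permutation. For $(k,\ell)\in\{1,\dots,n+1\}^2$ let $\pi_{n+1}^{(k,\ell)}\in\mathcal{S}_{n+1}$ be the permutation obtained from $\pi_n$ by insertion at $(k,\ell)$ (defined in the context). For $a,b\in\{0,1\}$ define $$N_{n+1}(a,b,\pi_n)=\mathrm{Card}\Big\{(k,\ell)\in\{1,\dots,n+1\}^2 \;:\; D\big(\pi_{n+1}^{(k,\ell)}\big)-D(\pi_n)=a,\ D\big((\pi_{n+1}^{(k,\ell)})^{ -1}\big)-D(\pi_n^{ -1})=b\Big\}.$$ Writing $D_n=D(\pi_n)$ and $D'_n=D(\pi_n^{ -1})$, we have $$N_{n+1}(a,b,\pi_n)=\begin{cases}(n-D_n)(n-D'_n)+n & \text{if } (a,b)=(1,1),\\ (n-D_n)(D'_n+1)-n & \text{if } (a,b)=(1,0),\\ (D_n+1)(n-D'_n)-n & \text{if } (a,b)=(0,1),\\ (D_n+1)(D'_n+1)+n & \text{if } (a,b)=(0,0).\end{cases}$$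
   Context: $\mathcal{S}_n$ is the symmetric group on $\{1,\dots,n\}$. For $\sigma\in\mathcal{S}_m$, $D(\sigma)=\#\{i\in\{1,\dots,m-1\}:\sigma(i)>\sigma(i+1)\}$ is its number of descents. Insertion at $(k,\ell)$: given $\pi_n\in\mathcal{S}_n$ and $(k,\ell)\in\{1,\dots,n+1\}^2$, define $\pi_{n+1}=\pi^{(k,\ell)}_{n+1}\in\mathcal{S}_{n+1}$ by $\pi_{n+1}(k)=\ell$; for $i<k$, $\pi_{n+1}(i)=\pi_n(i)$ if $\pi_n(i)<\ell$ and $\pi_{n+1}(i)=\pi_n(i)+1$ if $\pi_n(i)\ge\ell$; for $i>k$, $\pi_{n+1}(i)=\pi_n(i-1)$ if $\pi_n(i-1)<\ell$ and $\pi_{n+1}(i)=\pi_n(i-1)+1$ if $\pi_n(i-1)\ge \ell$. (Geometrically: $\pi_n$ is drawn as the points $(i/(n+1),\pi_n(i)/(n+1))$ in $[0,1]^2$, a point $u$ is placed in the open cell $](k-1)/(n+1),k/(n+1)[\times](\ell-1)/(n+1),\ell/(n+1)[$, and the new point is inserted there with relative orders preserved.) -}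

module Defs where

open import Data.Nat using (ℕ; zero; suc; _+_; _≟_)
open import Data.Fin using (Fin; zero; suc; inject₁; _<?_)
open import Data.Fin.Permutation using (Permutation′; _⟨$⟩ʳ_; flip; insert)
open import Data.List using (List; length; filter; allFin; cartesianProduct)
open import Data.Product using (_×_; _,_; proj₁; proj₂)
open import Relation.Nullary.Decidable using (_×-dec_)

descentsF : ∀ {m} → (Fin m → Fin m) → ℕ
descentsF {zero}  σ = 0
descentsF {suc m} σ = length (filter (λ i → σ (suc i) <? σ (inject₁ i)) (allFin m))

D : ∀ {m} → Permutation′ m → ℕ
D σ = descentsF (σ ⟨$⟩ʳ_)

-- Insertion at (k , ℓ) (0-indexed, i.e. k = paper's k - 1, ℓ = paper's ℓ - 1):
-- the new permutation sends k to ℓ and otherwise keeps relative orders.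
-- This is exactly stdlib's  insert : for i ≠ k it maps i to
-- punchIn ℓ (π (punchOut k i)), matching the paper's definition.
ins : ∀ {n} → Permutation′ n → Fin (suc n) → Fin (suc n) → Permutation′ (suc n)
ins π k ℓ = insert k ℓ π

N : ∀ {n} → ℕ → ℕ → Permutation′ n → ℕ
N {n} a b π =
  length (filter
    (λ p → (D (ins π (proj₁ p) (proj₂ p)) ≟ D π + a)
      ×-dec (D (flip (ins π (proj₁ p) (proj₂ p))) ≟ D (flip π) + b))
    (cartesianProduct (allFin (suc n)) (allFin (suc n))))

{-# OPTIONS --safe #-}
module Submission where

-- Pad π ∈ S_n by π(0) = 0 and π(n+1) = n+1. Inserting at (k, ℓ) puts ℓ between π(k-1) and π(k)
-- and pushes the old values ≥ ℓ up, so only the gap between them can change its status: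
--   D(π⁽ᵏˡ⁾) - D(π) = δ(k, ℓ) = 1 - [π(k-1) > π(k)] + [π(k) < ℓ] - [π(k-1) < ℓ]  ∈ {0, 1}.
-- Inverting exchanges the roles of k and ℓ, so D((π⁽ᵏˡ⁾)⁻¹) - D(π⁻¹) = δ′(k, ℓ) is the same
-- expression for π⁻¹ at (ℓ, k). As [δ = a] is affine in δ ∈ {0, 1}, each N(a, b) is a fixed
-- combination of the sums of 1, δ, δ′ and δδ′ over the (n+1)² cells. The bracket differences
-- telescope in k (to -1 for every ℓ), and summing their product with those of π⁻¹ by parts gives 1
-- for every ℓ because π(π⁻¹(ℓ)) = ℓ. Hence Σ δ = (n+1)(n - D), Σ δ′ = (n+1)(n - D′) and
-- Σ δδ′ = (n - D)(n - D′) + n.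

open import Defs
open import Data.Nat using (ℕ; suc; _≤_; _∸_; _*_)
open import Data.Integer using (ℤ; +_; _-_; _+_)
open import Data.Fin.Permutation using (Permutation′; flip)
open import Data.Product using (_×_)
open import Relation.Binary.PropositionalEquality using (_≡_)

open import Data.Nat using (zero; z≤n; s≤s)
import Data.Nat as ℕ
import Data.Nat.Properties as ℕP
open import Data.Integer using (0ℤ; 1ℤ; -1ℤ) renaming (_*_ to _·_)
import Data.Integer.Properties as ℤP
open import Data.Integer.Tactic.RingSolver using (solve-∀)
open import Data.Fin using (Fin; toℕ; inject₁; punchIn; punchOut)
import Data.Fin as Fin
open import Data.Fin.Properties using (toℕ<n; toℕ-inject₁; punchIn-punchOut)
open import Data.Fin.Permutation using (_⟨$⟩ʳ_; _⟨$⟩ˡ_; insert; insert-punchIn; inverseʳ)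
open import Data.List using (length; filter; tabulate; allFin; cartesianProduct; map; _++_)
open import Data.List.Properties using (length-filter; length-tabulate; filter-++; length-++; map-tabulate)
open import Data.Product using (_,_)
open import Function using (_∘_; id)
open import Relation.Binary.PropositionalEquality
  using (refl; sym; trans; cong; cong₂; subst; module ≡-Reasoning)
open import Relation.Nullary using (Dec; yes; no; contradiction)
open import Relation.Nullary.Decidable using (_×-dec_)
open import Relation.Unary using (Pred; Decidable)

open ≡-Reasoning

-- Iverson brackets and punching in on ℕ

⟦_<_⟧ : ℕ → ℕ → ℕ
⟦ _     < zero  ⟧ = 0
⟦ zero  < suc _ ⟧ = 1
⟦ suc x < suc y ⟧ = ⟦ x < y ⟧

⟦_≤_⟧ : ℕ → ℕ → ℕ
⟦ x ≤ y ⟧ = ⟦ x < suc y ⟧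

⟦<⟧≡1 : ∀ {x y} → x ℕ.< y → ⟦ x < y ⟧ ≡ 1
⟦<⟧≡1 {zero}  (s≤s _)   = refl
⟦<⟧≡1 {suc x} (s≤s x<y) = ⟦<⟧≡1 x<y

⟦<⟧≡0 : ∀ {x y} → y ≤ x → ⟦ x < y ⟧ ≡ 0
⟦<⟧≡0 z≤n       = refl
⟦<⟧≡0 (s≤s y≤x) = ⟦<⟧≡0 y≤x

⟦<⟧≤1 : ∀ x y → ⟦ x < y ⟧ ≤ 1
⟦<⟧≤1 _       zero    = z≤n
⟦<⟧≤1 zero    (suc _) = s≤s z≤n
⟦<⟧≤1 (suc x) (suc y) = ⟦<⟧≤1 x y

⟦<⟧+⟦≥⟧≡1 : ∀ x y → ⟦ x < y ⟧ ℕ.+ ⟦ y ≤ x ⟧ ≡ 1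
⟦<⟧+⟦≥⟧≡1 _       zero    = refl
⟦<⟧+⟦≥⟧≡1 zero    (suc _) = refl
⟦<⟧+⟦≥⟧≡1 (suc x) (suc y) = ⟦<⟧+⟦≥⟧≡1 x y

⟦<⟧≡1-⟦≥⟧ : ∀ x y → + ⟦ x < y ⟧ ≡ 1ℤ - + ⟦ y ≤ x ⟧
⟦<⟧≡1-⟦≥⟧ _       zero    = refl
⟦<⟧≡1-⟦≥⟧ zero    (suc _) = refl
⟦<⟧≡1-⟦≥⟧ (suc x) (suc y) = ⟦<⟧≡1-⟦≥⟧ x y

𝟙 : ∀ {p} {P : Set p} → Dec P → ℕ
𝟙 (yes _) = 1
𝟙 (no _)  = 0

𝟙-<? : ∀ x y → 𝟙 (x ℕ.<? y) ≡ ⟦ x < y ⟧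
𝟙-<? x y with x ℕ.<? y
... | yes x<y = sym (⟦<⟧≡1 x<y)
... | no  x≮y = sym (⟦<⟧≡0 (ℕP.≮⇒≥ x≮y))

𝟙-×-dec : ∀ {p q} {P : Set p} {Q : Set q} (P? : Dec P) (Q? : Dec Q) → 𝟙 (P? ×-dec Q?) ≡ 𝟙 P? ℕ.* 𝟙 Q?
𝟙-×-dec (yes _) (yes _) = refl
𝟙-×-dec (yes _) (no _)  = refl
𝟙-×-dec (no _)  (yes _) = refl
𝟙-×-dec (no _)  (no _)  = refl

𝟙-≟-cancelˡ : ∀ {y} x δ a → y ≡ x ℕ.+ δ → 𝟙 (y ℕ.≟ x ℕ.+ a) ≡ 𝟙 (δ ℕ.≟ a)
𝟙-≟-cancelˡ x δ a refl with x ℕ.+ δ ℕ.≟ x ℕ.+ a | δ ℕ.≟ a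
... | yes _   | yes _   = refl
... | no  _   | no  _   = refl
... | yes x+δ≡x+a | no δ≢a = contradiction (ℕP.+-cancelˡ-≡ x δ a x+δ≡x+a) δ≢a
... | no  x+δ≢x+a | yes δ≡a = contradiction (cong (x ℕ.+_) δ≡a) x+δ≢x+a

punchInℕ : ℕ → ℕ → ℕ
punchInℕ zero    v       = suc v
punchInℕ (suc i) zero    = zero
punchInℕ (suc i) (suc v) = suc (punchInℕ i v)

toℕ-punchIn : ∀ {n} (i : Fin (suc n)) (j : Fin n) → toℕ (punchIn i j) ≡ punchInℕ (toℕ i) (toℕ j)
toℕ-punchIn Fin.zero    j          = refl
toℕ-punchIn (Fin.suc i) Fin.zero    = refl
toℕ-punchIn (Fin.suc i) (Fin.suc j) = cong suc (toℕ-punchIn i j)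

punchInℕ-≥ : ∀ {i v} → i ≤ v → punchInℕ i v ≡ suc v
punchInℕ-≥ z≤n       = refl
punchInℕ-≥ (s≤s i≤v) = cong suc (punchInℕ-≥ i≤v)

⟦<⟧-punchInℕ : ∀ i a b → ⟦ punchInℕ i a < punchInℕ i b ⟧ ≡ ⟦ a < b ⟧
⟦<⟧-punchInℕ zero    a       b       = refl
⟦<⟧-punchInℕ (suc i) zero    zero    = refl
⟦<⟧-punchInℕ (suc i) zero    (suc b) = refl
⟦<⟧-punchInℕ (suc i) (suc a) zero    = refl
⟦<⟧-punchInℕ (suc i) (suc a) (suc b) = ⟦<⟧-punchInℕ i a b

⟦<punchInℕ⟧ : ∀ i a → ⟦ i < punchInℕ i a ⟧ ≡ ⟦ i ≤ a ⟧
⟦<punchInℕ⟧ zero    a       = refl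
⟦<punchInℕ⟧ (suc i) zero    = refl
⟦<punchInℕ⟧ (suc i) (suc a) = ⟦<punchInℕ⟧ i a

⟦punchInℕ<⟧ : ∀ i a → ⟦ punchInℕ i a < i ⟧ ≡ ⟦ a < i ⟧
⟦punchInℕ<⟧ zero    a       = refl
⟦punchInℕ<⟧ (suc i) zero    = refl
⟦punchInℕ<⟧ (suc i) (suc a) = ⟦punchInℕ<⟧ i a

-- The descents gained when a value just above l is inserted between neighbours a and b.
descentGain : ℕ → ℕ → ℕ → ℕ
descentGain l       zero    b       = ⟦ b ≤ l ⟧
descentGain l       (suc a) zero    = ⟦ l ≤ a ⟧
descentGain zero    (suc a) (suc b) = ⟦ a ≤ b ⟧
descentGain (suc l) (suc a) (suc b) = descentGain l a b

descentGain≤1 : ∀ l a b → descentGain l a b ≤ 1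
descentGain≤1 l       zero    b       = ⟦<⟧≤1 b (suc l)
descentGain≤1 l       (suc a) zero    = ⟦<⟧≤1 l (suc a)
descentGain≤1 zero    (suc a) (suc b) = ⟦<⟧≤1 a (suc b)
descentGain≤1 (suc l) (suc a) (suc b) = descentGain≤1 l a b

descentGain-spec : ∀ l a b → ⟦ l < a ⟧ ℕ.+ ⟦ b ≤ l ⟧ ≡ ⟦ b < a ⟧ ℕ.+ descentGain l a b
descentGain-spec l       zero    b       = refl
descentGain-spec l       (suc a) zero    = ℕP.+-comm ⟦ l ≤ a ⟧ 1
descentGain-spec zero    (suc a) (suc b) = sym (⟦<⟧+⟦≥⟧≡1 b a)
descentGain-spec (suc l) (suc a) (suc b) = descentGain-spec l a b

descentGain-ℤ : ∀ l a b →
  + descentGain l a b ≡ (1ℤ - + ⟦ b < a ⟧) + (+ ⟦ b ≤ l ⟧ - + ⟦ a ≤ l ⟧)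
descentGain-ℤ l a b = begin
  + descentGain l a b                                 ≡⟨ add-sub z (+ descentGain l a b) ⟩
  + (⟦ b < a ⟧ ℕ.+ descentGain l a b) - z             ≡⟨ cong (λ t → + t - z) (sym (descentGain-spec l a b)) ⟩
  + ⟦ l < a ⟧ + + ⟦ b ≤ l ⟧ - z                        ≡⟨ cong (λ t → t + + ⟦ b ≤ l ⟧ - z) (⟦<⟧≡1-⟦≥⟧ l a) ⟩
  (1ℤ - + ⟦ a ≤ l ⟧) + + ⟦ b ≤ l ⟧ - z                 ≡⟨ regroup (+ ⟦ a ≤ l ⟧) (+ ⟦ b ≤ l ⟧) z ⟩
  (1ℤ - z) + (+ ⟦ b ≤ l ⟧ - + ⟦ a ≤ l ⟧)               ∎
  where
  z = + ⟦ b < a ⟧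
  add-sub : ∀ z g → g ≡ (z + g) - z
  add-sub = solve-∀
  regroup : ∀ w y z → (1ℤ - w) + y - z ≡ (1ℤ - z) + (y - w)
  regroup = solve-∀

-- Sums over initial segments of ℕ

∑ : ℕ → (ℕ → ℤ) → ℤ
∑ zero    f = 0ℤ
∑ (suc n) f = f 0 + ∑ n (f ∘ suc)

∑∑ : ℕ → (ℕ → ℕ → ℤ) → ℤ
∑∑ n f = ∑ n (λ i → ∑ n (f i))

∑-cong : ∀ n {f g : ℕ → ℤ} → (∀ j → j ℕ.< n → f j ≡ g j) → ∑ n f ≡ ∑ n g
∑-cong zero    f≗g = refl
∑-cong (suc n) f≗g = cong₂ _+_ (f≗g 0 (s≤s z≤n)) (∑-cong n (λ j j<n → f≗g (suc j) (s≤s j<n)))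

∑-distrib-+ : ∀ n (f g : ℕ → ℤ) → ∑ n (λ j → f j + g j) ≡ ∑ n f + ∑ n g
∑-distrib-+ zero    f g = refl
∑-distrib-+ (suc n) f g = trans (cong (_+_ (f 0 + g 0)) (∑-distrib-+ n (f ∘ suc) (g ∘ suc)))
    (interchange (f 0) (g 0) (∑ n (f ∘ suc)) (∑ n (g ∘ suc)))
  where
  interchange : ∀ a b c d → a + b + (c + d) ≡ a + c + (b + d)
  interchange = solve-∀

∑-distrib-- : ∀ n (f g : ℕ → ℤ) → ∑ n (λ j → f j - g j) ≡ ∑ n f - ∑ n g
∑-distrib-- zero    f g = refl
∑-distrib-- (suc n) f g = trans (cong (_+_ (f 0 - g 0)) (∑-distrib-- n (f ∘ suc) (g ∘ suc)))
    (interchange (f 0) (g 0) (∑ n (f ∘ suc)) (∑ n (g ∘ suc)))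
  where
  interchange : ∀ a b c d → a - b + (c - d) ≡ a + c - (b + d)
  interchange = solve-∀

*-distribˡ-∑ : ∀ n c (f : ℕ → ℤ) → c · ∑ n f ≡ ∑ n (λ j → c · f j)
*-distribˡ-∑ zero    c f = ℤP.*-zeroʳ c
*-distribˡ-∑ (suc n) c f =
  trans (ℤP.*-distribˡ-+ c (f 0) _) (cong (_+_ (c · f 0)) (*-distribˡ-∑ n c (f ∘ suc)))

*-distribʳ-∑ : ∀ n c (f : ℕ → ℤ) → ∑ n f · c ≡ ∑ n (λ j → f j · c)
*-distribʳ-∑ zero    c f = ℤP.*-zeroˡ c
*-distribʳ-∑ (suc n) c f =
  trans (ℤP.*-distribʳ-+ c (f 0) _) (cong (_+_ (f 0 · c)) (*-distribʳ-∑ n c (f ∘ suc)))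

∑-const : ∀ n c → ∑ n (λ _ → c) ≡ + n · c
∑-const zero    c = sym (ℤP.*-zeroˡ c)
∑-const (suc n) c = trans (cong (_+_ c) (∑-const n c)) (add-one c (+ n))
  where
  add-one : ∀ c n → c + n · c ≡ (1ℤ + n) · c
  add-one = solve-∀

∑-comm : ∀ m n (f : ℕ → ℕ → ℤ) → ∑ m (λ i → ∑ n (f i)) ≡ ∑ n (λ j → ∑ m (λ i → f i j))
∑-comm zero    n f = sym (trans (∑-const n 0ℤ) (ℤP.*-zeroʳ (+ n)))
∑-comm (suc m) n f = trans (cong (_+_ (∑ n (f 0))) (∑-comm m n (f ∘ suc))) (sym (∑-distrib-+ n (f 0) _))

∑-last : ∀ n (f : ℕ → ℤ) → ∑ (suc n) f ≡ ∑ n f + f n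
∑-last zero    f = ℤP.+-comm (f 0) 0ℤ
∑-last (suc n) f = trans (cong (_+_ (f 0)) (∑-last n (f ∘ suc))) (sym (ℤP.+-assoc (f 0) _ _))

∑-telescope : ∀ n (f : ℕ → ℤ) → ∑ n (λ j → f (suc j) - f j) ≡ f n - f 0
∑-telescope zero    f = sym (ℤP.+-inverseʳ (f 0))
∑-telescope (suc n) f =
  trans (cong (_+_ (f 1 - f 0)) (∑-telescope n (f ∘ suc))) (telescope (f 0) (f 1) (f (suc n)))
  where
  telescope : ∀ a b c → b - a + (c - b) ≡ c - a
  telescope = solve-∀

∑-telescope-from : ∀ {a n} (f : ℕ → ℤ) → a ≤ n → ∑ n (λ j → + ⟦ a ≤ j ⟧ · (f (suc j) - f j)) ≡ f n - f a
∑-telescope-from {n = n} f z≤n =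
  trans (∑-cong n (λ j _ → ℤP.*-identityˡ (f (suc j) - f j))) (∑-telescope n f)
∑-telescope-from {suc a} {suc n} f (s≤s a≤n) =
  trans (ℤP.+-identityˡ _) (∑-telescope-from (f ∘ suc) a≤n)

∑∑-cong : ∀ N {f g : ℕ → ℕ → ℤ} → (∀ K L → f K L ≡ g K L) → ∑∑ N f ≡ ∑∑ N g
∑∑-cong N f≗g = ∑-cong N (λ K _ → ∑-cong N (λ L _ → f≗g K L))

∑∑-distrib-+ : ∀ N (f g : ℕ → ℕ → ℤ) → ∑∑ N (λ K L → f K L + g K L) ≡ ∑∑ N f + ∑∑ N g
∑∑-distrib-+ N f g = trans (∑-cong N (λ K _ → ∑-distrib-+ N (f K) (g K))) (∑-distrib-+ N _ _)

*-distribˡ-∑∑ : ∀ N c (f : ℕ → ℕ → ℤ) → c · ∑∑ N f ≡ ∑∑ N (λ K L → c · f K L)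
*-distribˡ-∑∑ N c f = trans (*-distribˡ-∑ N c _) (∑-cong N (λ K _ → *-distribˡ-∑ N c (f K)))

∑∑-const : ∀ N c → ∑∑ N (λ _ _ → c) ≡ c · (+ N · + N)
∑∑-const N c = begin
  ∑ N (λ _ → ∑ N (λ _ → c))  ≡⟨ ∑-cong N (λ _ _ → ∑-const N c) ⟩
  ∑ N (λ _ → + N · c)        ≡⟨ ∑-const N (+ N · c) ⟩
  + N · (+ N · c)            ≡⟨ reorder (+ N) c ⟩
  c · (+ N · + N)            ∎
  where
  reorder : ∀ n c → n · (n · c) ≡ c · (n · n)
  reorder = solve-∀

∑∑-bilinear : ∀ N (f g : ℕ → ℕ → ℤ) α β γ ε →
  ∑∑ N (λ K L → (α + β · f K L) · (γ + ε · g K L))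
    ≡ α · γ · (+ N · + N) + β · γ · ∑∑ N f + α · ε · ∑∑ N g + β · ε · ∑∑ N (λ K L → f K L · g K L)
∑∑-bilinear N f g α β γ ε = begin
  ∑∑ N (λ K L → (α + β · f K L) · (γ + ε · g K L))
    ≡⟨ ∑∑-cong N (λ K L → expand α β γ ε (f K L) (g K L)) ⟩
  ∑∑ N (λ K L → α · γ + β · γ · f K L + α · ε · g K L + β · ε · (f K L · g K L))
    ≡⟨ ∑∑-distrib-+ N _ (λ K L → β · ε · (f K L · g K L)) ⟩
  ∑∑ N (λ K L → α · γ + β · γ · f K L + α · ε · g K L) + ∑∑ N (λ K L → β · ε · (f K L · g K L))
    ≡⟨ cong (_+ _) (∑∑-distrib-+ N _ (λ K L → α · ε · g K L)) ⟩
  ∑∑ N (λ K L → α · γ + β · γ · f K L) + ∑∑ N (λ K L → α · ε · g K L) + _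
    ≡⟨ cong (λ t → t + _ + _) (∑∑-distrib-+ N (λ _ _ → α · γ) (λ K L → β · γ · f K L)) ⟩
  ∑∑ N (λ _ _ → α · γ) + ∑∑ N (λ K L → β · γ · f K L) + ∑∑ N (λ K L → α · ε · g K L)
    + ∑∑ N (λ K L → β · ε · (f K L · g K L))
    ≡⟨ cong₄ (∑∑-const N (α · γ)) (sym (*-distribˡ-∑∑ N (β · γ) f)) (sym (*-distribˡ-∑∑ N (α · ε) g))
             (sym (*-distribˡ-∑∑ N (β · ε) (λ K L → f K L · g K L))) ⟩
  α · γ · (+ N · + N) + β · γ · ∑∑ N f + α · ε · ∑∑ N g + β · ε · ∑∑ N (λ K L → f K L · g K L) ∎
  where
  expand : ∀ α β γ ε x y → (α + β · x) · (γ + ε · y) ≡ α · γ + β · γ · x + α · ε · y + β · ε · (x · y)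
  expand = solve-∀
  cong₄ : ∀ {a a′ b b′ c c′ d d′ : ℤ} → a ≡ a′ → b ≡ b′ → c ≡ c′ → d ≡ d′ → a + b + c + d ≡ a′ + b′ + c′ + d′
  cong₄ refl refl refl refl = refl

module _ (N : ℕ) (X : ℕ → ℕ → ℤ) (∑X : ∀ L → L ℕ.< N → ∑ N (λ K → X K L) ≡ -1ℤ) where

  ∑∑-first-moment : ∀ A → ∑∑ N (λ K L → A K + X K L) ≡ + N · (∑ N A - 1ℤ)
  ∑∑-first-moment A = begin
    ∑∑ N (λ K L → A K + X K L)              ≡⟨ ∑∑-distrib-+ N (λ K _ → A K) X ⟩
    ∑ N (λ K → ∑ N (λ _ → A K)) + ∑∑ N X    ≡⟨ cong₂ _+_ rows columns ⟩
    + N · ∑ N A + + N · -1ℤ                 ≡⟨ sym (ℤP.*-distribˡ-+ (+ N) (∑ N A) -1ℤ) ⟩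
    + N · (∑ N A - 1ℤ)                      ∎
    where
    rows : ∑ N (λ K → ∑ N (λ _ → A K)) ≡ + N · ∑ N A
    rows = trans (∑-cong N (λ K _ → ∑-const N (A K))) (sym (*-distribˡ-∑ N (+ N) A))
    columns : ∑∑ N X ≡ + N · -1ℤ
    columns = trans (∑-comm N N X) (trans (∑-cong N ∑X) (∑-const N -1ℤ))

  module _ (Y : ℕ → ℕ → ℤ) (∑Y : ∀ K → K ℕ.< N → ∑ N (λ L → Y L K) ≡ -1ℤ)
           (∑XY : ∀ L → L ℕ.< N → ∑ N (λ K → X K L · Y L K) ≡ 1ℤ) where

    ∑∑-second-moment : ∀ A B →
      ∑∑ N (λ K L → (A K + X K L) · (B L + Y L K)) ≡ (∑ N A - 1ℤ) · (∑ N B - 1ℤ) + (+ N - 1ℤ)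
    ∑∑-second-moment A B = begin
      ∑∑ N (λ K L → (A K + X K L) · W K L)
        ≡⟨ ∑∑-cong N (λ K L → ℤP.*-distribʳ-+ (W K L) (A K) (X K L)) ⟩
      ∑∑ N (λ K L → A K · W K L + X K L · W K L)
        ≡⟨ ∑∑-distrib-+ N (λ K L → A K · W K L) (λ K L → X K L · W K L) ⟩
      ∑∑ N (λ K L → A K · W K L) + ∑∑ N (λ K L → X K L · W K L)
        ≡⟨ cong₂ _+_ rows columns ⟩
      ∑ N A · (∑ N B - 1ℤ) + (+ N - ∑ N B)
        ≡⟨ regroup (∑ N A) (∑ N B) (+ N) ⟩
      (∑ N A - 1ℤ) · (∑ N B - 1ℤ) + (+ N - 1ℤ) ∎
      where
      flip-sign : ∀ b → -1ℤ · b + 1ℤ ≡ 1ℤ - b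
      flip-sign = solve-∀
      regroup : ∀ a b n → a · (b - 1ℤ) + (n - b) ≡ (a - 1ℤ) · (b - 1ℤ) + (n - 1ℤ)
      regroup = solve-∀
      W : ℕ → ℕ → ℤ
      W K L = B L + Y L K
      row : ∀ K → K ℕ.< N → ∑ N (λ L → A K · W K L) ≡ A K · (∑ N B - 1ℤ)
      row K K<N = begin
        ∑ N (λ L → A K · W K L)              ≡⟨ sym (*-distribˡ-∑ N (A K) (W K)) ⟩
        A K · ∑ N (W K)                      ≡⟨ cong (A K ·_) (∑-distrib-+ N B (λ L → Y L K)) ⟩
        A K · (∑ N B + ∑ N (λ L → Y L K))    ≡⟨ cong (λ t → A K · (∑ N B + t)) (∑Y K K<N) ⟩
        A K · (∑ N B - 1ℤ)                   ∎
      rows : ∑∑ N (λ K L → A K · W K L) ≡ ∑ N A · (∑ N B - 1ℤ)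
      rows = trans (∑-cong N row) (sym (*-distribʳ-∑ N (∑ N B - 1ℤ) A))
      column : ∀ L → L ℕ.< N → ∑ N (λ K → X K L · W K L) ≡ 1ℤ - B L
      column L L<N = begin
        ∑ N (λ K → X K L · W K L)
          ≡⟨ ∑-cong N (λ K _ → ℤP.*-distribˡ-+ (X K L) (B L) (Y L K)) ⟩
        ∑ N (λ K → X K L · B L + X K L · Y L K)
          ≡⟨ ∑-distrib-+ N (λ K → X K L · B L) (λ K → X K L · Y L K) ⟩
        ∑ N (λ K → X K L · B L) + ∑ N (λ K → X K L · Y L K)
          ≡⟨ cong₂ _+_ (sym (*-distribʳ-∑ N (B L) (λ K → X K L))) (∑XY L L<N) ⟩
        ∑ N (λ K → X K L) · B L + 1ℤ
          ≡⟨ cong (λ t → t · B L + 1ℤ) (∑X L L<N) ⟩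
        -1ℤ · B L + 1ℤ
          ≡⟨ flip-sign (B L) ⟩
        1ℤ - B L ∎
      columns : ∑∑ N (λ K L → X K L · W K L) ≡ + N - ∑ N B
      columns = begin
        ∑∑ N (λ K L → X K L · W K L)         ≡⟨ ∑-comm N N (λ K L → X K L · W K L) ⟩
        ∑ N (λ L → ∑ N (λ K → X K L · W K L)) ≡⟨ ∑-cong N column ⟩
        ∑ N (λ L → 1ℤ - B L)                  ≡⟨ ∑-distrib-- N (λ _ → 1ℤ) B ⟩
        ∑ N (λ _ → 1ℤ) - ∑ N B                ≡⟨ cong (_- ∑ N B) (trans (∑-const N 1ℤ) (ℤP.*-identityʳ (+ N))) ⟩
        + N - ∑ N B                           ∎

count-tabulate : ∀ {n p} {A : Set} {P : Pred A p} (P? : Decidable P) (t : Fin n → A) (f : ℕ → ℤ) →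
                 (∀ i → + 𝟙 (P? (t i)) ≡ f (toℕ i)) → + length (filter P? (tabulate t)) ≡ ∑ n f
count-tabulate {zero}  P? t f eq = refl
count-tabulate {suc n} P? t f eq with P? (t Fin.zero) | eq Fin.zero
... | yes _ | eq₀ = cong₂ _+_ eq₀ (count-tabulate P? (t ∘ Fin.suc) (f ∘ suc) (eq ∘ Fin.suc))
... | no  _ | eq₀ = trans (sym (ℤP.+-identityˡ _))
                      (cong₂ _+_ eq₀ (count-tabulate P? (t ∘ Fin.suc) (f ∘ suc) (eq ∘ Fin.suc)))

count-cartesianProduct : ∀ {m n p} {A B : Set} {P : Pred (A × B) p} (P? : Decidable P)
  (s : Fin m → A) (t : Fin n → B) (f : ℕ → ℕ → ℤ) →
  (∀ i j → + 𝟙 (P? (s i , t j)) ≡ f (toℕ i) (toℕ j)) →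
  + length (filter P? (cartesianProduct (tabulate s) (tabulate t))) ≡ ∑ m (λ i → ∑ n (f i))
count-cartesianProduct {zero}          P? s t f eq = refl
count-cartesianProduct {suc m} {n} P? s t f eq = begin
  + length (filter P? (row ++ rows))               ≡⟨ cong (+_ ∘ length) (filter-++ P? row rows) ⟩
  + length (filter P? row ++ filter P? rows)       ≡⟨ cong +_ (length-++ (filter P? row)) ⟩
  + length (filter P? row) + + length (filter P? rows)
    ≡⟨ cong₂ _+_ count-row (count-cartesianProduct P? (s ∘ Fin.suc) t (f ∘ suc) (eq ∘ Fin.suc)) ⟩
  ∑ n (f 0) + ∑ m (λ i → ∑ n (f (suc i)))          ∎
  where
  row = map (s Fin.zero ,_) (tabulate t)
  rows = cartesianProduct (tabulate (s ∘ Fin.suc)) (tabulate t)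
  count-row : + length (filter P? row) ≡ ∑ n (f 0)
  count-row = trans (cong (+_ ∘ length ∘ filter P?) (map-tabulate t (s Fin.zero ,_)))
                    (count-tabulate P? ((s Fin.zero ,_) ∘ t) (f 0) (eq Fin.zero))

-- Padded sequences and their descents

∀≤⇐∀Fin : ∀ {m} (P : ℕ → Set) → (∀ (i : Fin m) → P (toℕ i)) → P m → ∀ j → j ≤ m → P j
∀≤⇐∀Fin {zero}  P P-Fin P-m zero    z≤n       = P-m
∀≤⇐∀Fin {suc m} P P-Fin P-m zero    _         = P-Fin Fin.zero
∀≤⇐∀Fin {suc m} P P-Fin P-m (suc j) (s≤s j≤m) = ∀≤⇐∀Fin (P ∘ suc) (P-Fin ∘ Fin.suc) P-m j j≤m

lookupOr : ∀ {m} → (Fin m → ℕ) → ℕ → ℕ → ℕ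
lookupOr {zero}  f d _       = d
lookupOr {suc m} f d zero    = f Fin.zero
lookupOr {suc m} f d (suc j) = lookupOr (f ∘ Fin.suc) d j

lookupOr-toℕ : ∀ {m} (f : Fin m → ℕ) d i → lookupOr f d (toℕ i) ≡ f i
lookupOr-toℕ f d Fin.zero    = refl
lookupOr-toℕ f d (Fin.suc i) = lookupOr-toℕ (f ∘ Fin.suc) d i

lookupOr-end : ∀ {m} (f : Fin m → ℕ) d → lookupOr f d m ≡ d
lookupOr-end {zero}  f d = refl
lookupOr-end {suc m} f d = lookupOr-end (f ∘ Fin.suc) d

lookupOr-≤ : ∀ {m} (f : Fin m → ℕ) {d} → (∀ i → f i ≤ d) → ∀ j → lookupOr f d j ≤ d
lookupOr-≤ {zero}  f f≤d j       = ℕP.≤-refl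
lookupOr-≤ {suc m} f f≤d zero    = f≤d Fin.zero
lookupOr-≤ {suc m} f f≤d (suc j) = lookupOr-≤ (f ∘ Fin.suc) (f≤d ∘ Fin.suc) j

-- 0, σ 0 + 1, …, σ (m - 1) + 1, m + 1, m + 1, …: the paper's σ(0) = 0 and σ(m + 1) = m + 1
-- with the values of σ shifted to 1, …, m.
padded : ∀ {m} → (Fin m → Fin m) → ℕ → ℕ
padded     σ zero    = 0
padded {m} σ (suc j) = lookupOr (suc ∘ toℕ ∘ σ) (suc m) j

padded-suc-toℕ : ∀ {m} (σ : Fin m → Fin m) i → padded σ (suc (toℕ i)) ≡ suc (toℕ (σ i))
padded-suc-toℕ σ = lookupOr-toℕ (suc ∘ toℕ ∘ σ) _

padded-end : ∀ {m} (σ : Fin m → Fin m) → padded σ (suc m) ≡ suc m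
padded-end σ = lookupOr-end (suc ∘ toℕ ∘ σ) _

padded-≤ : ∀ {m} (σ : Fin m → Fin m) j → padded σ j ≤ suc m
padded-≤ σ zero    = z≤n
padded-≤ σ (suc j) = lookupOr-≤ (suc ∘ toℕ ∘ σ) (λ i → s≤s (ℕP.<⇒≤ (toℕ<n (σ i)))) j

padded-inverse : ∀ {n} (π : Permutation′ n) j → j ≤ suc n →
                 padded (π ⟨$⟩ʳ_) (padded (flip π ⟨$⟩ʳ_) j) ≡ j
padded-inverse     π zero    _         = refl
padded-inverse {n} π (suc j) (s≤s j≤n) =
  ∀≤⇐∀Fin (λ j → Eπ (Eι (suc j)) ≡ suc j) inverse-at-Fin inverse-at-end j j≤n
  where
  Eπ = padded (π ⟨$⟩ʳ_)
  Eι = padded (flip π ⟨$⟩ʳ_)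
  inverse-at-Fin : ∀ i → Eπ (Eι (suc (toℕ i))) ≡ suc (toℕ i)
  inverse-at-Fin i = begin
    Eπ (Eι (suc (toℕ i)))          ≡⟨ cong Eπ (padded-suc-toℕ (flip π ⟨$⟩ʳ_) i) ⟩
    Eπ (suc (toℕ (π ⟨$⟩ˡ i)))       ≡⟨ padded-suc-toℕ (π ⟨$⟩ʳ_) (π ⟨$⟩ˡ i) ⟩
    suc (toℕ (π ⟨$⟩ʳ (π ⟨$⟩ˡ i)))   ≡⟨ cong (suc ∘ toℕ) (inverseʳ π) ⟩
    suc (toℕ i)                    ∎
  inverse-at-end : Eπ (Eι (suc n)) ≡ suc n
  inverse-at-end = trans (cong Eπ (padded-end (flip π ⟨$⟩ʳ_))) (padded-end (π ⟨$⟩ʳ_))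

descentAt : (ℕ → ℕ) → ℕ → ℕ
descentAt f j = ⟦ f (suc j) < f j ⟧

descents : ℕ → (ℕ → ℕ) → ℤ
descents n f = ∑ n (λ j → + descentAt f j)

descents-cong : ∀ n {f g} → (∀ j → j ≤ n → f j ≡ g j) → descents n f ≡ descents n g
descents-cong n f≗g =
  ∑-cong n (λ j j<n → cong +_ (cong₂ ⟦_<_⟧ (f≗g (suc j) j<n) (f≗g j (ℕP.<⇒≤ j<n))))

descents-punchInℕ : ∀ n i f → descents n (punchInℕ i ∘ f) ≡ descents n f
descents-punchInℕ n i f = ∑-cong n (λ j _ → cong +_ (⟦<⟧-punchInℕ i (f (suc j)) (f j)))

descentsF-padded : ∀ {m} (σ : Fin m → Fin m) → + descentsF σ ≡ descents (suc m) (padded σ)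
descentsF-padded {zero}  σ = refl
-- The gaps next to the two padding values are never descents.
descentsF-padded {suc m} σ = begin
  + descentsF σ                      ≡⟨ count-tabulate descent? id interior interior-at ⟩
  ∑ m interior                       ≡⟨ sym (ℤP.+-identityʳ _) ⟩
  ∑ m interior + 0ℤ                  ≡⟨ cong (_+_ (∑ m interior)) (sym last-is-ascent) ⟩
  ∑ m interior + interior m          ≡⟨ sym (∑-last m interior) ⟩
  ∑ (suc m) interior                 ≡⟨ sym (ℤP.+-identityˡ _) ⟩
  descents (suc (suc m)) (padded σ)  ∎
  where
  E = padded σ
  descent? = λ i → σ (Fin.suc i) Fin.<? σ (inject₁ i)
  interior : ℕ → ℤ
  interior j = + descentAt E (suc j)
  interior-at : ∀ i → + 𝟙 (descent? i) ≡ interior (toℕ i)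
  interior-at i = cong +_ (trans (𝟙-<? _ _) (sym (cong₂ ⟦_<_⟧
    (padded-suc-toℕ σ (Fin.suc i))
    (trans (cong (E ∘ suc) (sym (toℕ-inject₁ i))) (padded-suc-toℕ σ (inject₁ i))))))
  last-is-ascent : interior m ≡ 0ℤ
  last-is-ascent = cong +_ (⟦<⟧≡0 (subst (E (suc m) ≤_) (sym (padded-end σ)) (padded-≤ σ (suc m))))

descentsF≤ : ∀ {m} (σ : Fin m → Fin m) → descentsF σ ≤ m
descentsF≤ {zero}  σ = z≤n
descentsF≤ {suc m} σ = ℕP.m≤n⇒m≤1+n
  (ℕP.≤-trans (length-filter _ (allFin m)) (ℕP.≤-reflexive (length-tabulate id)))

-- f 0, …, f p, v, f (p + 1), f (p + 2), …
splice : ℕ → ℕ → (ℕ → ℕ) → ℕ → ℕ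
splice p       v f zero          = f zero
splice zero    v f (suc zero)    = v
splice zero    v f (suc (suc j)) = f (suc j)
splice (suc p) v f (suc j)       = splice p v (f ∘ suc) j

splice-at : ∀ p v f → splice p v f (suc p) ≡ v
splice-at zero    v f = refl
splice-at (suc p) v f = splice-at p v (f ∘ suc)

splice-after : ∀ {p j} v f → p ≤ j → splice p v f (suc (suc j)) ≡ f (suc j)
splice-after v f z≤n       = refl
splice-after v f (s≤s p≤j) = splice-after v (f ∘ suc) p≤j

splice-punchIn : ∀ {m} v f (k : Fin (suc m)) (x : Fin m) →
                 splice (toℕ k) v f (suc (toℕ (punchIn k x))) ≡ f (suc (toℕ x))
splice-punchIn v f Fin.zero    x           = refl
splice-punchIn v f (Fin.suc k) Fin.zero    = refl
splice-punchIn v f (Fin.suc k) (Fin.suc x) = splice-punchIn v (f ∘ suc) k x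

descents-splice : ∀ {p n} v f → p ≤ n →
  descents (suc (suc n)) (splice p v f)
    ≡ descents (suc n) f - + descentAt f p + (+ ⟦ v < f p ⟧ + + ⟦ f (suc p) < v ⟧)
descents-splice {zero} {n} v f _ =
  regroup (+ ⟦ v < f 0 ⟧) (+ ⟦ f 1 < v ⟧) (+ descentAt f 0) (descents n (f ∘ suc))
  where
  regroup : ∀ a b c r → a + (b + r) ≡ c + r - c + (a + b)
  regroup = solve-∀
descents-splice {suc p} {suc n} v f (s≤s p≤n) =
  trans (cong (_+_ (+ descentAt f 0)) (descents-splice v (f ∘ suc) p≤n))
        (regroup (+ descentAt f 0) (descents (suc n) (f ∘ suc)) (+ descentAt f (suc p))
                 (+ ⟦ v < f (suc p) ⟧ + + ⟦ f (suc (suc p)) < v ⟧))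
  where
  regroup : ∀ c r d x → c + (r - d + x) ≡ c + r - d + x
  regroup = solve-∀

-- Insertion

gain : ∀ {m} → (Fin m → Fin m) → ℕ → ℕ → ℕ
gain σ K L = descentGain L (padded σ K) (padded σ (suc K))

gain≤1 : ∀ {m} (σ : Fin m → Fin m) K L → gain σ K L ≤ 1
gain≤1 σ K L = descentGain≤1 L (padded σ K) (padded σ (suc K))

record IsInsertion {m} (σ : Fin m → Fin m) (k ℓ : Fin (suc m)) (τ : Fin (suc m) → Fin (suc m)) : Set where
  field
    k↦ℓ             : τ k ≡ ℓ
    punchIn-commute : ∀ x → τ (punchIn k x) ≡ punchIn ℓ (σ x)

padded-insertion : ∀ {m σ k ℓ τ} → IsInsertion {m} σ k ℓ τ → ∀ j → j ≤ suc (suc m) →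
  padded τ j ≡ splice (toℕ k) (suc (toℕ ℓ)) (punchInℕ (suc (toℕ ℓ)) ∘ padded σ) j
padded-insertion ins zero _ = refl
padded-insertion {m} {σ} {k} {ℓ} {τ} ins (suc j) (s≤s j≤1+m) =
  ∀≤⇐∀Fin (λ j → padded τ (suc j) ≡ S (suc j)) at-Fin at-end j j≤1+m
  where
  open IsInsertion ins
  L = toℕ ℓ
  S = splice (toℕ k) (suc L) (punchInℕ (suc L) ∘ padded σ)
  at-punchIn : ∀ x → padded τ (suc (toℕ (punchIn k x))) ≡ S (suc (toℕ (punchIn k x)))
  at-punchIn x = begin
    padded τ (suc (toℕ (punchIn k x)))         ≡⟨ padded-suc-toℕ τ (punchIn k x) ⟩
    suc (toℕ (τ (punchIn k x)))                ≡⟨ cong (suc ∘ toℕ) (punchIn-commute x) ⟩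
    suc (toℕ (punchIn ℓ (σ x)))                ≡⟨ cong suc (toℕ-punchIn ℓ (σ x)) ⟩
    punchInℕ (suc L) (suc (toℕ (σ x)))         ≡⟨ cong (punchInℕ (suc L)) (sym (padded-suc-toℕ σ x)) ⟩
    punchInℕ (suc L) (padded σ (suc (toℕ x)))  ≡⟨ sym (splice-punchIn (suc L) _ k x) ⟩
    S (suc (toℕ (punchIn k x)))                ∎
  at-Fin : ∀ i → padded τ (suc (toℕ i)) ≡ S (suc (toℕ i))
  at-Fin i with k Fin.≟ i
  ... | yes refl = trans (padded-suc-toℕ τ k)
                     (trans (cong (suc ∘ toℕ) k↦ℓ) (sym (splice-at (toℕ k) (suc L) _)))
  ... | no  k≢i  = subst (λ i → padded τ (suc (toℕ i)) ≡ S (suc (toℕ i)))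
                     (punchIn-punchOut k≢i) (at-punchIn (punchOut k≢i))
  at-end : padded τ (suc (suc m)) ≡ S (suc (suc m))
  at-end = begin
    padded τ (suc (suc m))               ≡⟨ padded-end τ ⟩
    suc (suc m)                          ≡⟨ sym (punchInℕ-≥ (toℕ<n ℓ)) ⟩
    punchInℕ (suc L) (suc m)             ≡⟨ cong (punchInℕ (suc L)) (sym (padded-end σ)) ⟩
    punchInℕ (suc L) (padded σ (suc m))  ≡⟨ sym (splice-after (suc L) _ (ℕP.≤-pred (toℕ<n k))) ⟩
    S (suc (suc m))                      ∎

descentsF-insertion : ∀ {m σ k ℓ τ} → IsInsertion {m} σ k ℓ τ →
                      descentsF τ ≡ descentsF σ ℕ.+ gain σ (toℕ k) (toℕ ℓ)
descentsF-insertion {m} {σ} {k} {ℓ} {τ} ins = ℤP.+-injective (begin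
  + descentsF τ                                  ≡⟨ descentsF-padded τ ⟩
  descents (suc (suc m)) (padded τ)              ≡⟨ descents-cong (suc (suc m)) (padded-insertion ins) ⟩
  descents (suc (suc m)) (splice K (suc L) E⁺)   ≡⟨ descents-splice (suc L) E⁺ (ℕP.≤-pred (toℕ<n k)) ⟩
  descents (suc m) E⁺ - + descentAt E⁺ K + (+ ⟦ suc L < E⁺ K ⟧ + + ⟦ E⁺ (suc K) < suc L ⟧)
    ≡⟨ cong₂ (λ D d → D - + d + (+ ⟦ suc L < E⁺ K ⟧ + + ⟦ E⁺ (suc K) < suc L ⟧))
             (descents-punchInℕ (suc m) (suc L) E) (⟦<⟧-punchInℕ (suc L) b a) ⟩
  descents (suc m) E - + ⟦ b < a ⟧ + (+ ⟦ suc L < E⁺ K ⟧ + + ⟦ E⁺ (suc K) < suc L ⟧)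
    ≡⟨ cong₂ (λ x y → descents (suc m) E - + ⟦ b < a ⟧ + (+ x + + y))
             (⟦<punchInℕ⟧ (suc L) a) (⟦punchInℕ<⟧ (suc L) b) ⟩
  descents (suc m) E - + ⟦ b < a ⟧ + + (⟦ L < a ⟧ ℕ.+ ⟦ b ≤ L ⟧)
    ≡⟨ cong (λ t → descents (suc m) E - + ⟦ b < a ⟧ + + t) (descentGain-spec L a b) ⟩
  descents (suc m) E - + ⟦ b < a ⟧ + (+ ⟦ b < a ⟧ + + descentGain L a b)
    ≡⟨ cancel (descents (suc m) E) (+ ⟦ b < a ⟧) (+ descentGain L a b) ⟩
  descents (suc m) E + + descentGain L a b
    ≡⟨ cong (λ t → t + + descentGain L a b) (sym (descentsF-padded σ)) ⟩
  + descentsF σ + + descentGain L a b            ∎)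
  where
  K = toℕ k
  L = toℕ ℓ
  E = padded σ
  E⁺ = punchInℕ (suc L) ∘ E
  a = E K
  b = E (suc K)
  cancel : ∀ d z g → d - z + (z + g) ≡ d + g
  cancel = solve-∀

insert-isInsertion : ∀ {m} (π : Permutation′ m) k ℓ → IsInsertion (π ⟨$⟩ʳ_) k ℓ (insert k ℓ π ⟨$⟩ʳ_)
insert-isInsertion π k ℓ = record { k↦ℓ = insert-k↦ℓ ; punchIn-commute = insert-punchIn k ℓ π }
  where
  insert-k↦ℓ : insert k ℓ π ⟨$⟩ʳ k ≡ ℓ
  insert-k↦ℓ with k Fin.≟ k
  ... | yes _   = refl
  ... | no  k≢k = contradiction refl k≢k

flip-insert : ∀ {m} (π : Permutation′ m) k ℓ x → flip (insert k ℓ π) ⟨$⟩ʳ x ≡ insert ℓ k (flip π) ⟨$⟩ʳ x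
flip-insert π k ℓ x with ℓ Fin.≟ x
... | yes _ = refl
... | no  _ = refl

flip-insert-isInsertion : ∀ {m} (π : Permutation′ m) k ℓ →
                          IsInsertion (flip π ⟨$⟩ʳ_) ℓ k (flip (insert k ℓ π) ⟨$⟩ʳ_)
flip-insert-isInsertion π k ℓ = record
  { k↦ℓ             = trans (flip-insert π k ℓ ℓ) k↦ℓ
  ; punchIn-commute = λ x → trans (flip-insert π k ℓ (punchIn ℓ x)) (punchIn-commute x)
  }
  where open IsInsertion (insert-isInsertion (flip π) ℓ k)

-- Moments of the descent gains

crossing : (ℕ → ℕ) → ℕ → ℕ → ℤ
crossing E K L = + ⟦ E (suc K) ≤ L ⟧ - + ⟦ E K ≤ L ⟧

gain-ℤ : ∀ {m} (σ : Fin m → Fin m) K L →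
         + gain σ K L ≡ (1ℤ - + descentAt (padded σ) K) + crossing (padded σ) K L
gain-ℤ σ K L = descentGain-ℤ L (padded σ K) (padded σ (suc K))

∑-ascents : ∀ {m} (σ : Fin m → Fin m) →
            ∑ (suc m) (λ K → 1ℤ - + descentAt (padded σ) K) ≡ + suc m - + descentsF σ
∑-ascents {m} σ = begin
  ∑ (suc m) (λ K → 1ℤ - + descentAt (padded σ) K)
    ≡⟨ ∑-distrib-- (suc m) (λ _ → 1ℤ) (λ K → + descentAt (padded σ) K) ⟩
  ∑ (suc m) (λ _ → 1ℤ) - descents (suc m) (padded σ)
    ≡⟨ cong₂ _-_ (trans (∑-const (suc m) 1ℤ) (ℤP.*-identityʳ (+ suc m))) (sym (descentsF-padded σ)) ⟩
  + suc m - + descentsF σ                          ∎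

∑-crossing : ∀ {m} (σ : Fin m → Fin m) L → L ℕ.< suc m →
             ∑ (suc m) (λ K → crossing (padded σ) K L) ≡ -1ℤ
∑-crossing {m} σ L L<1+m = begin
  ∑ (suc m) (λ K → crossing (padded σ) K L)  ≡⟨ ∑-telescope (suc m) (λ j → + ⟦ padded σ j ≤ L ⟧) ⟩
  + ⟦ padded σ (suc m) ≤ L ⟧ - 1ℤ             ≡⟨ cong (λ j → + ⟦ j ≤ L ⟧ - 1ℤ) (padded-end σ) ⟩
  + ⟦ suc m ≤ L ⟧ - 1ℤ                        ≡⟨ cong (λ t → + t - 1ℤ) (⟦<⟧≡0 L<1+m) ⟩
  -1ℤ                                         ∎

∑-crossing-product : ∀ {n} (π : Permutation′ n) L → L ℕ.< suc n →
  ∑ (suc n) (λ K → crossing (padded (π ⟨$⟩ʳ_)) K L · crossing (padded (flip π ⟨$⟩ʳ_)) L K) ≡ 1ℤ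
-- Summation by parts: as a function of K the second factor is ⟦ b ≤ K ⟧ - ⟦ a ≤ K ⟧.
∑-crossing-product {n} π L L<1+n = begin
  ∑ (suc n) (λ K → crossing Eπ K L · (+ ⟦ b ≤ K ⟧ - + ⟦ a ≤ K ⟧))
    ≡⟨ ∑-cong (suc n) (λ K _ → distrib (crossing Eπ K L) (+ ⟦ b ≤ K ⟧) (+ ⟦ a ≤ K ⟧)) ⟩
  ∑ (suc n) (λ K → + ⟦ b ≤ K ⟧ · Δf K - + ⟦ a ≤ K ⟧ · Δf K)
    ≡⟨ ∑-distrib-- (suc n) (λ K → + ⟦ b ≤ K ⟧ · Δf K) (λ K → + ⟦ a ≤ K ⟧ · Δf K) ⟩
  ∑ (suc n) (λ K → + ⟦ b ≤ K ⟧ · Δf K) - ∑ (suc n) (λ K → + ⟦ a ≤ K ⟧ · Δf K)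
    ≡⟨ cong₂ _-_ (∑-telescope-from f (padded-≤ (flip π ⟨$⟩ʳ_) (suc L)))
                 (∑-telescope-from f (padded-≤ (flip π ⟨$⟩ʳ_) L)) ⟩
  (f (suc n) - f b) - (f (suc n) - f a)
    ≡⟨ cancel (f (suc n)) (f b) (f a) ⟩
  f a - f b
    ≡⟨ cong₂ (λ x y → + ⟦ x ≤ L ⟧ - + ⟦ y ≤ L ⟧)
             (padded-inverse π L (ℕP.<⇒≤ L<1+n)) (padded-inverse π (suc L) L<1+n) ⟩
  + ⟦ L ≤ L ⟧ - + ⟦ suc L ≤ L ⟧
    ≡⟨ cong₂ (λ x y → + x - + y) (⟦<⟧≡1 (ℕP.n<1+n L)) (⟦<⟧≡0 (ℕP.≤-refl {L})) ⟩
  1ℤ ∎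
  where
  Eπ = padded (π ⟨$⟩ʳ_)
  a = padded (flip π ⟨$⟩ʳ_) L
  b = padded (flip π ⟨$⟩ʳ_) (suc L)
  f : ℕ → ℤ
  f j = + ⟦ Eπ j ≤ L ⟧
  Δf : ℕ → ℤ
  Δf K = f (suc K) - f K
  distrib : ∀ x y z → x · (y - z) ≡ y · x - z · x
  distrib = solve-∀
  cancel : ∀ x y z → (x - y) - (x - z) ≡ z - y
  cancel = solve-∀

∑∑-gain : ∀ {m} (σ : Fin m → Fin m) →
          ∑∑ (suc m) (λ K L → + gain σ K L) ≡ + suc m · (+ m - + descentsF σ)
∑∑-gain {m} σ = begin
  ∑∑ (suc m) (λ K L → + gain σ K L)
    ≡⟨ ∑∑-cong (suc m) (gain-ℤ σ) ⟩
  ∑∑ (suc m) (λ K L → (1ℤ - + descentAt (padded σ) K) + crossing (padded σ) K L)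
    ≡⟨ ∑∑-first-moment (suc m) (crossing (padded σ)) (∑-crossing σ) (λ K → 1ℤ - + descentAt (padded σ) K) ⟩
  + suc m · (∑ (suc m) (λ K → 1ℤ - + descentAt (padded σ) K) - 1ℤ)
    ≡⟨ cong (λ t → + suc m · (t - 1ℤ)) (∑-ascents σ) ⟩
  + suc m · (+ suc m - + descentsF σ - 1ℤ)
    ≡⟨ cong (+ suc m ·_) (drop-one (+ m) (+ descentsF σ)) ⟩
  + suc m · (+ m - + descentsF σ) ∎
  where
  drop-one : ∀ m d → 1ℤ + m - d - 1ℤ ≡ m - d
  drop-one = solve-∀

∑∑-gain-product : ∀ {n} (π : Permutation′ n) →
  ∑∑ (suc n) (λ K L → + gain (π ⟨$⟩ʳ_) K L · + gain (flip π ⟨$⟩ʳ_) L K)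
    ≡ (+ n - + D π) · (+ n - + D (flip π)) + + n
∑∑-gain-product {n} π = begin
  ∑∑ (suc n) (λ K L → + gain σ K L · + gain ι L K)
    ≡⟨ ∑∑-cong (suc n) (λ K L → cong₂ _·_ (gain-ℤ σ K L) (gain-ℤ ι L K)) ⟩
  ∑∑ (suc n) (λ K L → (A K + crossing (padded σ) K L) · (B L + crossing (padded ι) L K))
    ≡⟨ ∑∑-second-moment (suc n) (crossing (padded σ)) (∑-crossing σ) (crossing (padded ι)) (∑-crossing ι)
                        (∑-crossing-product π) A B ⟩
  (∑ (suc n) A - 1ℤ) · (∑ (suc n) B - 1ℤ) + (+ suc n - 1ℤ)
    ≡⟨ cong₂ (λ x y → (x - 1ℤ) · (y - 1ℤ) + (+ suc n - 1ℤ)) (∑-ascents σ) (∑-ascents ι) ⟩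
  (+ suc n - + D π - 1ℤ) · (+ suc n - + D (flip π) - 1ℤ) + (+ suc n - 1ℤ)
    ≡⟨ drop-ones (+ n) (+ D π) (+ D (flip π)) ⟩
  (+ n - + D π) · (+ n - + D (flip π)) + + n ∎
  where
  σ = π ⟨$⟩ʳ_
  ι = flip π ⟨$⟩ʳ_
  A B : ℕ → ℤ
  A K = 1ℤ - + descentAt (padded σ) K
  B L = 1ℤ - + descentAt (padded ι) L
  drop-ones : ∀ n d d′ → (1ℤ + n - d - 1ℤ) · (1ℤ + n - d′ - 1ℤ) + (1ℤ + n - 1ℤ) ≡ (n - d) · (n - d′) + n
  drop-ones = solve-∀

-- Counting insertions

pos-∸ : ∀ {m k} → k ≤ m → + (m ∸ k) ≡ + m - + k
pos-∸ {m} {k} k≤m = sym (trans (ℤP.m-n≡m⊖n m k) (ℤP.⊖-≥ k≤m))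

record AffineOnBits (a : ℕ) (α β : ℤ) : Set where
  field
    𝟙-≟-affine : ∀ {x} → x ≤ 1 → + 𝟙 (x ℕ.≟ a) ≡ α + β · + x

𝟙-≟1-affine : AffineOnBits 1 0ℤ 1ℤ
𝟙-≟1-affine = record { 𝟙-≟-affine = λ { z≤n → refl ; (s≤s z≤n) → refl } }

𝟙-≟0-affine : AffineOnBits 0 1ℤ -1ℤ
𝟙-≟0-affine = record { 𝟙-≟-affine = λ { z≤n → refl ; (s≤s z≤n) → refl } }

module Counts {n} (π : Permutation′ n) where

  p q : ℤ
  p = + n - + D π
  q = + n - + D (flip π)

  P Q : ℕ → ℕ → ℕ
  P K L = gain (π ⟨$⟩ʳ_) K L
  Q K L = gain (flip π ⟨$⟩ʳ_) L K

  N-as-∑∑ : ∀ a b → + N a b π ≡ ∑∑ (suc n) (λ K L → + 𝟙 (P K L ℕ.≟ a) · + 𝟙 (Q K L ℕ.≟ b))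
  N-as-∑∑ a b = count-cartesianProduct _ id id (λ K L → + 𝟙 (P K L ℕ.≟ a) · + 𝟙 (Q K L ℕ.≟ b)) indicator
    where
    indicator : ∀ k ℓ → + 𝟙 ((D (ins π k ℓ) ℕ.≟ D π ℕ.+ a) ×-dec (D (flip (ins π k ℓ)) ℕ.≟ D (flip π) ℕ.+ b))
                        ≡ + 𝟙 (P (toℕ k) (toℕ ℓ) ℕ.≟ a) · + 𝟙 (Q (toℕ k) (toℕ ℓ) ℕ.≟ b)
    indicator k ℓ = begin
      + 𝟙 (D? ×-dec D⁻¹?)      ≡⟨ cong +_ (𝟙-×-dec D? D⁻¹?) ⟩
      + (𝟙 D? ℕ.* 𝟙 D⁻¹?)      ≡⟨ ℤP.pos-* (𝟙 D?) (𝟙 D⁻¹?) ⟩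
      + 𝟙 D? · + 𝟙 D⁻¹?
        ≡⟨ cong₂ (λ x y → + x · + y)
                 (𝟙-≟-cancelˡ (D π) _ a (descentsF-insertion (insert-isInsertion π k ℓ)))
                 (𝟙-≟-cancelˡ (D (flip π)) _ b (descentsF-insertion (flip-insert-isInsertion π k ℓ))) ⟩
      + 𝟙 (P (toℕ k) (toℕ ℓ) ℕ.≟ a) · + 𝟙 (Q (toℕ k) (toℕ ℓ) ℕ.≟ b) ∎
      where
      D?   = D (ins π k ℓ) ℕ.≟ D π ℕ.+ a
      D⁻¹? = D (flip (ins π k ℓ)) ℕ.≟ D (flip π) ℕ.+ b

  N-expansion : ∀ {a b α β γ ε} → AffineOnBits a α β → AffineOnBits b γ ε →
    + N a b π ≡ α · γ · (+ suc n · + suc n) + β · γ · (+ suc n · p) + α · ε · (+ suc n · q)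
                + β · ε · (p · q + + n)
  N-expansion {a} {b} {α} {β} {γ} {ε} 𝟙≟a 𝟙≟b = begin
    + N a b π
      ≡⟨ N-as-∑∑ a b ⟩
    ∑∑ (suc n) (λ K L → + 𝟙 (P K L ℕ.≟ a) · + 𝟙 (Q K L ℕ.≟ b))
      ≡⟨ ∑∑-cong (suc n) (λ K L → cong₂ _·_ (𝟙-≟-affine 𝟙≟a (gain≤1 (π ⟨$⟩ʳ_) K L))
                                                    (𝟙-≟-affine 𝟙≟b (gain≤1 (flip π ⟨$⟩ʳ_) L K))) ⟩
    ∑∑ (suc n) (λ K L → (α + β · + P K L) · (γ + ε · + Q K L))
      ≡⟨ ∑∑-bilinear (suc n) (λ K L → + P K L) (λ K L → + Q K L) α β γ ε ⟩
    α · γ · (+ suc n · + suc n) + β · γ · ∑∑ (suc n) (λ K L → + P K L)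
      + α · ε · ∑∑ (suc n) (λ K L → + Q K L) + β · ε · ∑∑ (suc n) (λ K L → + P K L · + Q K L)
      ≡⟨ cong₃ (∑∑-gain (π ⟨$⟩ʳ_))
               (trans (∑-comm (suc n) (suc n) (λ K L → + Q K L)) (∑∑-gain (flip π ⟨$⟩ʳ_)))
               (∑∑-gain-product π) ⟩
    α · γ · (+ suc n · + suc n) + β · γ · (+ suc n · p) + α · ε · (+ suc n · q) + β · ε · (p · q + + n) ∎
    where
    open AffineOnBits
    cong₃ : ∀ {x x′ y y′ z z′} → x ≡ x′ → y ≡ y′ → z ≡ z′ →
            α · γ · (+ suc n · + suc n) + β · γ · x + α · ε · y + β · ε · z
              ≡ α · γ · (+ suc n · + suc n) + β · γ · x′ + α · ε · y′ + β · ε · z′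
    cong₃ refl refl refl = refl

  N₁₁ : + N 1 1 π ≡ p · q + + n
  N₁₁ = trans (N-expansion 𝟙-≟1-affine 𝟙-≟1-affine) (simplify (+ n) (+ D π) (+ D (flip π)))
    where
    simplify : ∀ n d d′ →
      0ℤ · 0ℤ · ((1ℤ + n) · (1ℤ + n)) + 1ℤ · 0ℤ · ((1ℤ + n) · (n - d)) + 0ℤ · 1ℤ · ((1ℤ + n) · (n - d′))
        + 1ℤ · 1ℤ · ((n - d) · (n - d′) + n) ≡ (n - d) · (n - d′) + n
    simplify = solve-∀

  N₁₀ : + N 1 0 π ≡ p · (+ D (flip π) + 1ℤ) - + n
  N₁₀ = trans (N-expansion 𝟙-≟1-affine 𝟙-≟0-affine) (simplify (+ n) (+ D π) (+ D (flip π)))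
    where
    simplify : ∀ n d d′ →
      0ℤ · 1ℤ · ((1ℤ + n) · (1ℤ + n)) + 1ℤ · 1ℤ · ((1ℤ + n) · (n - d)) + 0ℤ · -1ℤ · ((1ℤ + n) · (n - d′))
        + 1ℤ · -1ℤ · ((n - d) · (n - d′) + n) ≡ (n - d) · (d′ + 1ℤ) - n
    simplify = solve-∀

  N₀₁ : + N 0 1 π ≡ (+ D π + 1ℤ) · q - + n
  N₀₁ = trans (N-expansion 𝟙-≟0-affine 𝟙-≟1-affine) (simplify (+ n) (+ D π) (+ D (flip π)))
    where
    simplify : ∀ n d d′ →
      1ℤ · 0ℤ · ((1ℤ + n) · (1ℤ + n)) + -1ℤ · 0ℤ · ((1ℤ + n) · (n - d)) + 1ℤ · 1ℤ · ((1ℤ + n) · (n - d′))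
        + -1ℤ · 1ℤ · ((n - d) · (n - d′) + n) ≡ (d + 1ℤ) · (n - d′) - n
    simplify = solve-∀

  N₀₀ : + N 0 0 π ≡ (+ D π + 1ℤ) · (+ D (flip π) + 1ℤ) + + n
  N₀₀ = trans (N-expansion 𝟙-≟0-affine 𝟙-≟0-affine) (simplify (+ n) (+ D π) (+ D (flip π)))
    where
    simplify : ∀ n d d′ →
      1ℤ · 1ℤ · ((1ℤ + n) · (1ℤ + n)) + -1ℤ · 1ℤ · ((1ℤ + n) · (n - d)) + 1ℤ · -1ℤ · ((1ℤ + n) · (n - d′))
        + -1ℤ · -1ℤ · ((n - d) · (n - d′) + n) ≡ (d + 1ℤ) · (d′ + 1ℤ) + n
    simplify = solve-∀

theorem2p1 : (n : ℕ) → 1 ≤ n → (π : Permutation′ n) →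
    (+ N 1 1 π ≡ + ((n ∸ D π) * (n ∸ D (flip π))) + + n)
    × (+ N 1 0 π ≡ + ((n ∸ D π) * (D (flip π) Data.Nat.+ 1)) - + n)
    × (+ N 0 1 π ≡ + ((D π Data.Nat.+ 1) * (n ∸ D (flip π))) - + n)
    × (+ N 0 0 π ≡ + ((D π Data.Nat.+ 1) * (D (flip π) Data.Nat.+ 1)) + + n)
theorem2p1 n _ π =
    trans N₁₁ (cong (λ t → t + + n) (sym (pos-*-cast (n ∸ D π) (n ∸ D (flip π)) n-Dπ n-Dι)))
  , trans N₁₀ (cong (λ t → t - + n) (sym (pos-*-cast (n ∸ D π) (D (flip π) ℕ.+ 1) n-Dπ refl)))
  , trans N₀₁ (cong (λ t → t - + n) (sym (pos-*-cast (D π ℕ.+ 1) (n ∸ D (flip π)) refl n-Dι)))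
  , trans N₀₀ (cong (λ t → t + + n) (sym (pos-*-cast (D π ℕ.+ 1) (D (flip π) ℕ.+ 1) refl refl)))
  where
  open Counts π
  n-Dπ : + (n ∸ D π) ≡ p
  n-Dπ = pos-∸ (descentsF≤ (π ⟨$⟩ʳ_))
  n-Dι : + (n ∸ D (flip π)) ≡ q
  n-Dι = pos-∸ (descentsF≤ (flip π ⟨$⟩ʳ_))
  pos-*-cast : ∀ x y {x′ y′} → + x ≡ x′ → + y ≡ y′ → + (x * y) ≡ x′ · y′
  pos-*-cast x y refl refl = ℤP.pos-* x y
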